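{- Let $\pi\in\mathfrak{S}_n$ be indecomposable and $s\in[n]$. The map $c\mapsto\mathrm{CanonTop}(c)$ is a bijection from the set $\mathrm{MinRec}_s(G_\pi)$ of minimal recurrent configurations on $G_\pi$ with sink $s$ to the set of $(\pi,s)$-compatible ordered set partitions of $[n]$.
   Context: $G_\pi$: vertex set $[n]$, $a<b$ adjacent iff $b$ appears before $a$ in $\pi$ (i.e. they form an inversion); indecomposable: no $k<n$ with $\{\pi_1,\ldots,\pi_k\}=[k]$. Sandpile model with sink $s$: configuration $c\in\mathbb{Z}_{\ge0}^n$, $d_i$ the degree; toppling an unstable vertex $i$ ($c_i\ge d_i$) removes $d_i$ grains from $i$ and adds one to each neighbour. $c$ is recurrent if $c_s=d_s$, $c_i<d_i$ for $i\ne s$, and some ordering $s=v_1,\ldots,v_n$ of all vertices can be toppled successively from $c$. $\mathrm{level}(c)=\sum_ic_i-|E|$; $c$ is minimal recurrent if recurrent with level $0$. $\mathrm{CanonTop}(c)$ is the ordered partition $P_0=\{s\},P_1,\ldots$ where $P_i$ is the set of non-sink unstable vertices after toppling all of $P_0,\ldots,P_{i-1}$ from $c$. An ordered set partition $P_0,\ldots,P_k$ of $[n]$ is $(\pi,s)$-compatible if (1) $P_0=\{s\}$; (2) for each $j$, the elements of $P_j$ appear in increasing order in $\pi$ (no two form an inversion); (3) for every $j\ge1$ and $i\in P_j$ there exists $i'\in P_{j-1}$ such that $i,i'$ form an inversion of $\pi$. -}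

module Defs where

open import Data.Nat as ℕ using (ℕ; zero; suc; _+_; _∸_; _≤_; _<ᵇ_)
import Data.Empty
open import Data.Bool using (Bool; true; false; _∧_; _∨_; not; if_then_else_)
open import Data.Fin as Fin using (Fin; toℕ; _≟_)
open import Data.Fin.Permutation using (Permutation′; _⟨$⟩ʳ_; _⟨$⟩ˡ_)
open import Data.List using (List; []; _∷_; filter; allFin; concat; map; length)
open import Data.Nat.ListAction using (sum)
open import Data.List.Membership.Propositional using (_∈_)
open import Data.List.Relation.Unary.All using (All)
open import Data.List.Relation.Unary.Linked using (Linked)
open import Data.List.Relation.Binary.Permutation.Propositional using (_↭_)
open import Data.Product using (Σ; ∃; _×_; _,_)
open import Data.Unit using (⊤)
open import Relation.Binary.PropositionalEquality using (_≡_; _≢_)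
open import Relation.Nullary using (¬_; does)
open import Relation.Nullary.Decidable using (⌊_⌋)

-- Permutations π ∈ 𝔖ₙ, vertices/values are Fin n (i.e. [n] shifted to 0..n-1).
-- π is read as a word π₁ … πₙ :  the letter at position p is  π ⟨$⟩ʳ p.
-- The position of the value v in the word is  π ⟨$⟩ˡ v.

pos : ∀ {n} → Permutation′ n → Fin n → ℕ
pos π v = toℕ (π ⟨$⟩ˡ v)

inv? : ∀ {n} → Permutation′ n → Fin n → Fin n → Bool
inv? π a b = ((toℕ a <ᵇ toℕ b) ∧ (pos π b <ᵇ pos π a))
           ∨ ((toℕ b <ᵇ toℕ a) ∧ (pos π a <ᵇ pos π b))

Adj : ∀ {n} → Permutation′ n → Fin n → Fin n → Set
Adj π a b = inv? π a b ≡ true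

-- Indecomposable: no k with 1 ≤ k < n such that {π₁,…,π_k} = [k].
-- (With 0-indexing: the letters at positions 0..k-1 are exactly the values 0..k-1;
--  since π is a bijection this is equivalent to the inclusion below.)
Indecomposable : ∀ {n} → Permutation′ n → Set
Indecomposable {n} π =
  ∀ k → 1 ≤ k → k ℕ.< n →
  ¬ (∀ (p : Fin n) → toℕ p ℕ.< k → toℕ (π ⟨$⟩ʳ p) ℕ.< k)

Config : ℕ → Set
Config n = Fin n → ℕ

deg : ∀ {n} → Permutation′ n → Fin n → ℕ
deg π i = length (filter (λ j → inv? π i j ≡? true) (allFin _))
  where
  open import Data.Bool.Properties using () renaming (_≟_ to _≡?_)

numEdges : ∀ {n} → Permutation′ n → ℕ
numEdges {n} π =
  sum (map (λ a → length (filter (λ b → ((toℕ a <ᵇ toℕ b) ∧ inv? π a b) ≡? true)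
                                 (allFin n)))
           (allFin n))
  where
  open import Data.Bool.Properties using () renaming (_≟_ to _≡?_)

total : ∀ {n} → Config n → ℕ
total {n} c = sum (map c (allFin n))

topple : ∀ {n} → Permutation′ n → Config n → Fin n → Config n
topple π c i j =
  if ⌊ j ≟ i ⌋ then c i ∸ deg π i
  else (if inv? π i j then suc (c j) else c j)

Legal : ∀ {n} → Permutation′ n → Config n → List (Fin n) → Set
Legal π c []       = ⊤
Legal π c (v ∷ vs) = deg π v ≤ c v × Legal π (topple π c v) vs

Recurrent : ∀ {n} → Permutation′ n → Fin n → Config n → Set
Recurrent {n} π s c =
  c s ≡ deg π s ×
  (∀ i → i ≢ s → c i ℕ.< deg π i) ×
  Σ (List (Fin n)) (λ vs → (s ∷ vs) ↭ allFin n × Legal π c (s ∷ vs))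

-- level(c) = Σ cᵢ − |E| ; minimal recurrent = recurrent of level 0
MinRecurrent : ∀ {n} → Permutation′ n → Fin n → Config n → Set
MinRecurrent π s c = Recurrent π s c × total c ≡ numEdges π

-- Ordered set partitions: a list of blocks P₀,…,P_k, each block a
-- nonempty strictly increasing list of vertices (canonical representation
-- of a finite set), the concatenation of the blocks being a permutation
-- of [n] (blocks disjoint and covering).

NonEmpty : ∀ {A : Set} → List A → Set
NonEmpty []      = Data.Empty.⊥
NonEmpty (_ ∷ _) = ⊤

OrderedSetPartition : ∀ {n} → List (List (Fin n)) → Set
OrderedSetPartition {n} P =
  All (λ B → NonEmpty B × Linked Fin._<_ B) P × concat P ↭ allFin n

LinkedBlocks : ∀ {n} → Permutation′ n → List (Fin n) → List (Fin n) → Set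
LinkedBlocks π B B' = All (λ i → ∃ λ i' → i' ∈ B × Adj π i i') B'

NoInversions : ∀ {n} → Permutation′ n → List (Fin n) → Set
NoInversions π B = ∀ {i j} → i ∈ B → j ∈ B → ¬ Adj π i j

Compatible : ∀ {n} → Permutation′ n → Fin n → List (List (Fin n)) → Set
Compatible π s []      = Data.Empty.⊥
Compatible π s (P₀ ∷ P) =
  OrderedSetPartition (P₀ ∷ P) ×
  P₀ ≡ s ∷ [] ×
  All (NoInversions π) (P₀ ∷ P) ×
  Linked (LinkedBlocks π) (P₀ ∷ P)

-- The process stops
-- when no non-sink vertex is unstable; fuel n suffices for recurrent c
-- (blocks are nonempty and pairwise disjoint).

toppleAll : ∀ {n} → Permutation′ n → Config n → List (Fin n) → Config n
toppleAll π c []       = c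
toppleAll π c (v ∷ vs) = toppleAll π (topple π c v) vs

unstableNonSink : ∀ {n} → Permutation′ n → Fin n → Config n → List (Fin n)
unstableNonSink {n} π s c =
  filter (λ i → ((deg π i ℕ.≤ᵇ c i) ∧ not ⌊ i ≟ s ⌋) ≡? true) (allFin n)
  where
  open import Data.Bool.Properties using () renaming (_≟_ to _≡?_)

canonSteps : ∀ {n} → ℕ → Permutation′ n → Fin n → Config n → List (List (Fin n))
canonSteps zero    π s c = []
canonSteps (suc k) π s c with unstableNonSink π s c
... | []     = []
... | U@(_ ∷ _) = U ∷ canonSteps k π s (toppleAll π c U)

canonTop : ∀ {n} → Permutation′ n → Fin n → Config n → List (List (Fin n))
canonTop {n} π s c = (s ∷ []) ∷ canonSteps n π s (topple π c s)

-- A legal toppling order Q of a configuration c satisfies deg v ≤ c v + (number of neighbours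
-- of v preceding it in Q) for every vertex v.  These neighbour counts add up to |E|, so at
-- level zero every inequality is an equality: a minimal recurrent configuration is
-- c v = deg v − #(neighbours of v before v in Q) for each of its legal orders Q.
-- Applied to the order of CanonTop(c), this equation shows that no block contains an inversion,
-- and a vertex entering a block was stable one step earlier, so it has a neighbour in the
-- previous block: CanonTop(c) is compatible, and it determines c.  Conversely, for a compatible
-- partition the configuration deg v − #(neighbours of v in earlier positions) is minimal
-- recurrent, and at each stage of its canonical toppling exactly the next block becomes unstable.

module Submission where

open import Defs
open import Data.Bool as Bool using (Bool; true; false; _∧_; not; if_then_else_)
open import Data.Bool.Properties using (∨-comm; ¬-not; T-≡) renaming (_≟_ to _≟ᵇ_)
open import Data.Empty using (⊥-elim)
open import Data.Fin as Fin using (Fin; toℕ; _≟_)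
import Data.Fin.Properties as Fin
open import Data.Fin.Permutation using (Permutation′)
open import Data.List using (List; []; _∷_; _++_; [_]; filter; allFin; map; length; concat)
open import Data.List.Properties using (++-assoc; ++-identityʳ; length-++; length-tabulate; ∷-injectiveʳ)
open import Data.List.Membership.Propositional using (_∈_; _∉_)
open import Data.List.Membership.Propositional.Properties
  using (∈-∃++; ∈-++⁻; ∈-++⁺ˡ; ∈-++⁺ʳ; ∈-filter⁺; ∈-filter⁻; ∈-allFin)
open import Data.List.Relation.Binary.Permutation.Propositional using (_↭_; prep; swap; ↭-sym; ↭-trans; ↭⇒↭ₛ)
open import Data.List.Relation.Binary.Permutation.Propositional.Properties as ↭
  using (filter-↭; ↭-length; shift; ∈-resp-↭)
import Data.List.Relation.Binary.Permutation.Setoid.Properties as ↭ₛ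
open import Data.List.Relation.Binary.Pointwise using (Pointwise-≡⇒≡)
open import Data.List.Relation.Unary.All as All using (All; []; _∷_)
import Data.List.Relation.Unary.All.Properties as All
open import Data.List.Relation.Unary.AllPairs as AllPairs using (AllPairs; []; _∷_)
import Data.List.Relation.Unary.AllPairs.Properties as AllPairs
open import Data.List.Relation.Unary.Any as Any using (here; there)
open import Data.List.Relation.Unary.Any.Properties using (¬Any[])
open import Data.List.Relation.Unary.Linked as Linked using (Linked; []; [-]; _∷_)
import Data.List.Relation.Unary.Linked.Properties as Linked
open import Data.List.Relation.Unary.Sorted.TotalOrder.Properties using (↗↭↗⇒≋)
open import Data.List.Relation.Unary.Unique.Propositional using (Unique)
import Data.List.Relation.Unary.Unique.Propositional.Properties as Unique
open import Data.Nat using (ℕ; zero; suc; _+_; _∸_; _≤_; _<_; _<ᵇ_; _≤ᵇ_; z≤n; s≤s)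
open import Data.Nat.ListAction using (sum)
import Data.Nat.ListAction.Properties as ℕ
open import Data.Nat.Properties hiding (_≟_)
open import Algebra.Properties.CommutativeSemigroup +-commutativeSemigroup
  using (xy∙z≈y∙xz; x∙yz≈y∙xz) renaming (interchange to +-interchange)
open import Data.Product using (Σ; ∃; _×_; _,_; proj₁; proj₂)
open import Data.Sum using (inj₁; inj₂)
open import Data.Unit using (tt)
open import Function using (_∘_; id; Equivalence)
open import Relation.Nullary using (¬_; Dec; yes; no)
open import Relation.Nullary.Decidable using (⌊_⌋)
open import Relation.Binary.PropositionalEquality
  using (_≡_; _≢_; refl; sym; trans; cong; cong₂; subst; setoid; module ≡-Reasoning)

-- Counting and summing over lists

𝟙 : Bool → ℕ
𝟙 true  = 1
𝟙 false = 0

count : {A : Set} → (A → Bool) → List A → ℕ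
count p []       = 0
count p (x ∷ xs) = 𝟙 (p x) + count p xs

sumOver : {A : Set} → (A → ℕ) → List A → ℕ
sumOver f xs = sum (map f xs)

module _ {A : Set} where

  Unique-resp-↭ : {xs ys : List A} → xs ↭ ys → Unique xs → Unique ys
  Unique-resp-↭ xs↭ys = ↭ₛ.Unique-resp-↭ (setoid A) (↭⇒↭ₛ xs↭ys)

  Unique-++⁻ˡ : ∀ xs {ys : List A} → Unique (xs ++ ys) → Unique xs
  Unique-++⁻ˡ []       _          = []
  Unique-++⁻ˡ (x ∷ xs) (x∉ ∷ uxs) = All.++⁻ˡ xs x∉ ∷ Unique-++⁻ˡ xs uxs

  Unique-++-disjoint : ∀ {xs ys : List A} {x} → Unique (xs ++ ys) → x ∈ xs → x ∉ ys
  Unique-++-disjoint {_ ∷ xs} (x∉ ∷ _) (here refl) x∈ys = All.lookup x∉ (∈-++⁺ʳ xs x∈ys) refl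
  Unique-++-disjoint {_ ∷ xs} (_ ∷ u)  (there x∈xs) x∈ys = Unique-++-disjoint u x∈xs x∈ys

  private
    extract : {x : A} {ys : List A} → x ∈ ys → Σ (List A) λ zs → ys ↭ x ∷ zs
    extract {x} x∈ys with ∈-∃++ x∈ys
    ... | as , bs , refl = as ++ bs , shift x as bs

    ∈-extract : {x y : A} {ys zs : List A} → ys ↭ x ∷ zs → y ∈ ys → y ≢ x → y ∈ zs
    ∈-extract ys↭ y∈ys y≢x with ∈-resp-↭ ys↭ y∈ys
    ... | here y≡x = ⊥-elim (y≢x y≡x)
    ... | there y∈zs = y∈zs

  Unique-⊆⇒↭ : {xs ys : List A} → Unique xs → Unique ys →
               (∀ {x} → x ∈ xs → x ∈ ys) → (∀ {x} → x ∈ ys → x ∈ xs) → xs ↭ ys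
  Unique-⊆⇒↭ {[]}     {[]}    _ _ _ _ = _↭_.refl
  Unique-⊆⇒↭ {[]}     {_ ∷ _} _ _ _ ys⊆ with ys⊆ (here refl)
  ... | ()
  Unique-⊆⇒↭ {x ∷ xs} (x∉xs ∷ uxs) uys xs⊆ ys⊆ with extract (xs⊆ (here refl))
  ... | zs , ys↭ with Unique-resp-↭ ys↭ uys
  ... | x∉zs ∷ uzs = ↭-trans (prep x (Unique-⊆⇒↭ uxs uzs xs⊆zs zs⊆xs)) (↭-sym ys↭)
    where
    xs⊆zs : ∀ {y} → y ∈ xs → y ∈ zs
    xs⊆zs y∈xs = ∈-extract ys↭ (xs⊆ (there y∈xs)) λ y≡x → All.lookup x∉xs y∈xs (sym y≡x)
    zs⊆xs : ∀ {y} → y ∈ zs → y ∈ xs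
    zs⊆xs y∈zs with ys⊆ (∈-resp-↭ (↭-sym ys↭) (there y∈zs))
    ... | here refl  = ⊥-elim (All.lookup x∉zs y∈zs refl)
    ... | there y∈xs = y∈xs

  length<length-++-∷ : ∀ xs {y : A} {ys} → length xs < length (xs ++ y ∷ ys)
  length<length-++-∷ []       = s≤s z≤n
  length<length-++-∷ (x ∷ xs) = s≤s (length<length-++-∷ xs)

  length-filter≡count : (p : A → Bool) (xs : List A) →
                        length (filter (λ x → p x ≟ᵇ true) xs) ≡ count p xs
  length-filter≡count p []       = refl
  length-filter≡count p (x ∷ xs) with p x
  ... | true  = cong suc (length-filter≡count p xs)
  ... | false = length-filter≡count p xs

  count-↭ : (p : A → Bool) {xs ys : List A} → xs ↭ ys → count p xs ≡ count p ys
  count-↭ p {xs} {ys} xs↭ys = begin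
    count p xs                                ≡⟨ length-filter≡count p xs ⟨
    length (filter (λ x → p x ≟ᵇ true) xs)  ≡⟨ ↭-length (filter-↭ _ xs↭ys) ⟩
    length (filter (λ x → p x ≟ᵇ true) ys)  ≡⟨ length-filter≡count p ys ⟩
    count p ys                                ∎
    where open ≡-Reasoning

  count-++ : (p : A → Bool) (xs ys : List A) → count p (xs ++ ys) ≡ count p xs + count p ys
  count-++ p []       ys = refl
  count-++ p (x ∷ xs) ys = trans (cong (𝟙 (p x) +_) (count-++ p xs ys)) (sym (+-assoc (𝟙 (p x)) _ _))

  count-cong : {p q : A → Bool} {xs : List A} → All (λ x → p x ≡ q x) xs → count p xs ≡ count q xs
  count-cong []            = refl
  count-cong (px≡qx ∷ p≗q) = cong₂ _+_ (cong 𝟙 px≡qx) (count-cong p≗q)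

  count-const-true : (xs : List A) → count (λ _ → true) xs ≡ length xs
  count-const-true []       = refl
  count-const-true (x ∷ xs) = cong suc (count-const-true xs)

  count>0⇒∃ : (p : A → Bool) (xs : List A) → 0 < count p xs → ∃ λ x → x ∈ xs × p x ≡ true
  count>0⇒∃ p (x ∷ xs) count>0 with p x in px
  ... | true  = x , here refl , px
  ... | false with count>0⇒∃ p xs count>0
  ... | y , y∈xs , py = y , there y∈xs , py

  ∃⇒count>0 : (p : A → Bool) {xs : List A} {x : A} → x ∈ xs → p x ≡ true → 0 < count p xs
  ∃⇒count>0 p {y ∷ _}  (here refl) py rewrite py = s≤s z≤n
  ∃⇒count>0 p {y ∷ xs} (there x∈xs) py = ≤-trans (∃⇒count>0 p x∈xs py) (m≤n+m _ (𝟙 (p y)))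

  count-mono-⊆ : (p : A → Bool) {xs ys : List A} → Unique xs → (∀ {x} → x ∈ xs → x ∈ ys) →
                 count p xs ≤ count p ys
  count-mono-⊆ p {[]}     _            _    = z≤n
  count-mono-⊆ p {x ∷ xs} {ys} (x∉xs ∷ uxs) xs⊆ with extract (xs⊆ (here refl))
  ... | zs , ys↭ = begin
    𝟙 (p x) + count p xs ≤⟨ +-monoʳ-≤ (𝟙 (p x)) (count-mono-⊆ p uxs xs⊆zs) ⟩
    count p (x ∷ zs)     ≡⟨ count-↭ p ys↭ ⟨
    count p ys           ∎
    where
    open ≤-Reasoning
    xs⊆zs : ∀ {y} → y ∈ xs → y ∈ zs
    xs⊆zs y∈xs = ∈-extract ys↭ (xs⊆ (there y∈xs)) λ y≡x → All.lookup x∉xs y∈xs (sym y≡x)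

  length-mono-⊆ : {xs ys : List A} → Unique xs → (∀ {x} → x ∈ xs → x ∈ ys) → length xs ≤ length ys
  length-mono-⊆ {xs} {ys} uxs xs⊆ys = begin
    length xs                  ≡⟨ count-const-true xs ⟨
    count (λ _ → true) xs      ≤⟨ count-mono-⊆ _ uxs xs⊆ys ⟩
    count (λ _ → true) ys      ≡⟨ count-const-true ys ⟩
    length ys                  ∎
    where open ≤-Reasoning

  sumOver-+ : (f g : A → ℕ) (xs : List A) → sumOver (λ x → f x + g x) xs ≡ sumOver f xs + sumOver g xs
  sumOver-+ f g []       = refl
  sumOver-+ f g (x ∷ xs) = trans (cong (f x + g x +_) (sumOver-+ f g xs))
                                 (+-interchange (f x) (g x) (sumOver f xs) (sumOver g xs))

  sumOver-𝟙 : (p : A → Bool) (xs : List A) → sumOver (λ x → 𝟙 (p x)) xs ≡ count p xs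
  sumOver-𝟙 p []       = refl
  sumOver-𝟙 p (x ∷ xs) = cong (𝟙 (p x) +_) (sumOver-𝟙 p xs)

  sumOver-cong : {f g : A → ℕ} {xs : List A} → All (λ x → f x ≡ g x) xs → sumOver f xs ≡ sumOver g xs
  sumOver-cong []             = refl
  sumOver-cong (fx≡gx ∷ f≗g) = cong₂ _+_ fx≡gx (sumOver-cong f≗g)

  sumOver-↭ : (f : A → ℕ) {xs ys : List A} → xs ↭ ys → sumOver f xs ≡ sumOver f ys
  sumOver-↭ f xs↭ys = ℕ.sum-↭ (↭.map⁺ f xs↭ys)

  sumOver-mono-≤ : {f g : A → ℕ} {xs : List A} → All (λ x → f x ≤ g x) xs → sumOver f xs ≤ sumOver g xs
  sumOver-mono-≤ []             = z≤n
  sumOver-mono-≤ (fx≤gx ∷ f≤g) = +-mono-≤ fx≤gx (sumOver-mono-≤ f≤g)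

  sumOver-≡⇒pointwise : {f g : A → ℕ} {xs : List A} → All (λ x → f x ≤ g x) xs →
                          sumOver f xs ≡ sumOver g xs → All (λ x → f x ≡ g x) xs
  sumOver-≡⇒pointwise []                     _  = []
  sumOver-≡⇒pointwise {f} {g} {x ∷ xs} (fx≤gx ∷ f≤g) eq = fx≡gx ∷ sumOver-≡⇒pointwise f≤g Σf≡Σg
    where
    Σf≤Σg : sumOver f xs ≤ sumOver g xs
    Σf≤Σg = sumOver-mono-≤ f≤g
    fx≡gx : f x ≡ g x
    fx≡gx = ≤-antisym fx≤gx (+-cancelʳ-≤ (sumOver f xs) (g x) (f x)
              (≤-trans (+-monoʳ-≤ (g x) Σf≤Σg) (≤-reflexive (sym eq))))
    Σf≡Σg : sumOver f xs ≡ sumOver g xs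
    Σf≡Σg = +-cancelˡ-≡ (f x) _ _ (trans eq (cong (_+ sumOver g xs) (sym fx≡gx)))

StrictlySorted : ∀ {n} → List (Fin n) → Set
StrictlySorted = Linked Fin._<_

StrictlySorted⇒Unique : ∀ {n} {xs : List (Fin n)} → StrictlySorted xs → Unique xs
StrictlySorted⇒Unique sorted = AllPairs.map Fin.<⇒≢ (Linked.Linked⇒AllPairs Fin.<-trans sorted)

StrictlySorted-≡ : ∀ {n} {xs ys : List (Fin n)} → StrictlySorted xs → StrictlySorted ys →
                   (∀ {x} → x ∈ xs → x ∈ ys) → (∀ {x} → x ∈ ys → x ∈ xs) → xs ≡ ys
StrictlySorted-≡ {n} sxs sys xs⊆ys ys⊆xs = Pointwise-≡⇒≡
  (↗↭↗⇒≋ (Fin.≤-totalOrder n) (Linked.map <⇒≤ sxs) (Linked.map <⇒≤ sys)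
    (↭⇒↭ₛ (Unique-⊆⇒↭ (StrictlySorted⇒Unique sxs) (StrictlySorted⇒Unique sys) xs⊆ys ys⊆xs)))

allFin-sorted : ∀ n → StrictlySorted (allFin n)
allFin-sorted n = Linked.AllPairs⇒Linked (AllPairs.tabulate⁺-< id)

↭-allFin⇒Unique : ∀ {n} {Q : List (Fin n)} → Q ↭ allFin n → Unique Q
↭-allFin⇒Unique {n} Q↭ = Unique-resp-↭ (↭-sym Q↭) (Unique.allFin⁺ n)

↭-allFin⇒∈ : ∀ {n} {Q : List (Fin n)} → Q ↭ allFin n → ∀ w → w ∈ Q
↭-allFin⇒∈ Q↭ w = ∈-resp-↭ (↭-sym Q↭) (∈-allFin w)

<ᵇ-irrefl : ∀ m → (m <ᵇ m) ≡ false
<ᵇ-irrefl m = ¬-not λ m<ᵇm → <-irrefl refl (<ᵇ⇒< m m (Equivalence.from T-≡ m<ᵇm))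

<⇒<ᵇ≡true : ∀ {m k} → m < k → (m <ᵇ k) ≡ true
<⇒<ᵇ≡true m<k = Equivalence.to T-≡ (<⇒<ᵇ m<k)

≤⇒<ᵇ≡false : ∀ {m k} → k ≤ m → (m <ᵇ k) ≡ false
≤⇒<ᵇ≡false {m} {k} k≤m = ¬-not λ m<ᵇk → <⇒≱ (<ᵇ⇒< m k (Equivalence.from T-≡ m<ᵇk)) k≤m

-- The inversion graph and toppling

module _ {n : ℕ} (π : Permutation′ n) where

  inv?-sym : ∀ a b → inv? π a b ≡ inv? π b a
  inv?-sym a b = ∨-comm ((toℕ a <ᵇ toℕ b) ∧ (pos π b <ᵇ pos π a)) ((toℕ b <ᵇ toℕ a) ∧ (pos π a <ᵇ pos π b))

  inv?-irrefl : ∀ a → inv? π a a ≡ false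
  inv?-irrefl a rewrite <ᵇ-irrefl (toℕ a) = refl

  Adj⇒≢ : ∀ {a b} → Adj π a b → a ≢ b
  Adj⇒≢ {a} adj refl with trans (sym adj) (inv?-irrefl a)
  ... | ()

  adjCount : List (Fin n) → Fin n → ℕ
  adjCount T v = count (λ u → inv? π u v) T

  adjCount-++ : ∀ T U v → adjCount (T ++ U) v ≡ adjCount T v + adjCount U v
  adjCount-++ T U v = count-++ _ T U

  deg≡adjCount-allFin : ∀ v → deg π v ≡ adjCount (allFin n) v
  deg≡adjCount-allFin v = trans (length-filter≡count (inv? π v) (allFin n)) (count-cong (All.universal (inv?-sym v) (allFin n)))

  adjCount≤deg : ∀ {T} v → Unique T → adjCount T v ≤ deg π v
  adjCount≤deg v uT = ≤-trans (count-mono-⊆ _ uT (λ _ → ∈-allFin _)) (≤-reflexive (sym (deg≡adjCount-allFin v)))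

  topple-self : ∀ (c : Config n) v → topple π c v v ≡ c v ∸ deg π v
  topple-self c v with v ≟ v
  ... | yes _   = refl
  ... | no v≢v = ⊥-elim (v≢v refl)

  topple-other : ∀ (c : Config n) {v j} → j ≢ v → topple π c v j ≡ 𝟙 (inv? π v j) + c j
  topple-other c {v} {j} j≢v with j ≟ v
  ... | yes j≡v = ⊥-elim (j≢v j≡v)
  ... | no _ with inv? π v j
  ...   | true  = refl
  ...   | false = refl

  toppleAll-++ : ∀ (c : Config n) T U → toppleAll π c (T ++ U) ≡ toppleAll π (toppleAll π c T) U
  toppleAll-++ c []      U = refl
  toppleAll-++ c (v ∷ T) U = toppleAll-++ (topple π c v) T U

  toppleAll-∉ : ∀ (c : Config n) L {j} → j ∉ L → toppleAll π c L j ≡ c j + adjCount L j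
  toppleAll-∉ c []      _  = sym (+-identityʳ _)
  toppleAll-∉ c (v ∷ L) {j} j∉ = begin
    toppleAll π (topple π c v) L j        ≡⟨ toppleAll-∉ (topple π c v) L (j∉ ∘ there) ⟩
    topple π c v j + adjCount L j         ≡⟨ cong (_+ adjCount L j) (topple-other c (j∉ ∘ here)) ⟩
    (𝟙 (inv? π v j) + c j) + adjCount L j ≡⟨ xy∙z≈y∙xz (𝟙 (inv? π v j)) (c j) (adjCount L j) ⟩
    c j + adjCount (v ∷ L) j              ∎
    where open ≡-Reasoning

  toppleAll-∈ : ∀ (c : Config n) L {j} → Legal π c L → Unique L → j ∈ L →
                toppleAll π c L j + deg π j ≡ c j + adjCount L j
  toppleAll-∈ c (v ∷ L) (dv≤cv , _) (v∉L ∷ _) (here refl) = begin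
    toppleAll π (topple π c v) L v + d      ≡⟨ cong (_+ d) (toppleAll-∉ _ L (λ v∈L → All.lookup v∉L v∈L refl)) ⟩
    (topple π c v v + adjCount L v) + d     ≡⟨ cong (λ x → (x + adjCount L v) + d) (topple-self c v) ⟩
    ((c v ∸ d) + adjCount L v) + d          ≡⟨ +-assoc (c v ∸ d) _ d ⟩
    (c v ∸ d) + (adjCount L v + d)          ≡⟨ cong ((c v ∸ d) +_) (+-comm (adjCount L v) d) ⟩
    (c v ∸ d) + (d + adjCount L v)          ≡⟨ +-assoc (c v ∸ d) d _ ⟨
    ((c v ∸ d) + d) + adjCount L v          ≡⟨ cong (_+ adjCount L v) (m∸n+n≡m dv≤cv) ⟩
    c v + adjCount L v                      ≡⟨ cong (λ b → c v + (𝟙 b + adjCount L v)) (inv?-irrefl v) ⟨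
    c v + adjCount (v ∷ L) v                ∎
    where
    open ≡-Reasoning
    d : ℕ
    d = deg π v
  toppleAll-∈ c (v ∷ L) {j} (_ , lg) (v∉L ∷ uL) (there j∈L) = begin
    toppleAll π (topple π c v) L j + deg π j ≡⟨ toppleAll-∈ (topple π c v) L lg uL j∈L ⟩
    topple π c v j + adjCount L j            ≡⟨ cong (_+ adjCount L j) (topple-other c j≢v) ⟩
    (𝟙 (inv? π v j) + c j) + adjCount L j    ≡⟨ xy∙z≈y∙xz (𝟙 (inv? π v j)) (c j) (adjCount L j) ⟩
    c j + adjCount (v ∷ L) j                 ∎
    where
    open ≡-Reasoning
    j≢v : j ≢ v
    j≢v j≡v = All.lookup v∉L j∈L (sym j≡v)

  Legal-++⁺ : ∀ (c : Config n) T U → Legal π c T → Legal π (toppleAll π c T) U → Legal π c (T ++ U)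
  Legal-++⁺ c []      U _            lgU = lgU
  Legal-++⁺ c (v ∷ T) U (dv≤cv , lgT) lgU = dv≤cv , Legal-++⁺ (topple π c v) T U lgT lgU

  Legal-++⁻ : ∀ (c : Config n) T U → Legal π c (T ++ U) → Legal π c T × Legal π (toppleAll π c T) U
  Legal-++⁻ c []      U lg            = tt , lg
  Legal-++⁻ c (v ∷ T) U (dv≤cv , lg) with Legal-++⁻ (topple π c v) T U lg
  ... | lgT , lgU = (dv≤cv , lgT) , lgU

  -- Legal orders and minimal recurrence

  adjBefore : List (Fin n) → Fin n → ℕ
  adjBefore []       v = 0
  adjBefore (x ∷ xs) v = if ⌊ v ≟ x ⌋ then 0 else 𝟙 (inv? π x v) + adjBefore xs v

  adjBefore-self : ∀ v xs → adjBefore (v ∷ xs) v ≡ 0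
  adjBefore-self v xs with v ≟ v
  ... | yes _   = refl
  ... | no v≢v = ⊥-elim (v≢v refl)

  +-adjBefore-self : ∀ m v xs → m + adjBefore (v ∷ xs) v ≡ m
  +-adjBefore-self m v xs = trans (cong (m +_) (adjBefore-self v xs)) (+-identityʳ m)

  adjBefore-other : ∀ {v x} xs → v ≢ x → adjBefore (x ∷ xs) v ≡ 𝟙 (inv? π x v) + adjBefore xs v
  adjBefore-other {v} {x} xs v≢x with v ≟ x
  ... | yes v≡x = ⊥-elim (v≢x v≡x)
  ... | no _    = refl

  adjBefore-++ : ∀ X Y {v} → v ∉ X → adjBefore (X ++ Y) v ≡ adjCount X v + adjBefore Y v
  adjBefore-++ []      Y v∉X = refl
  adjBefore-++ (x ∷ X) Y {v} v∉X = begin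
    adjBefore (x ∷ X ++ Y) v                       ≡⟨ adjBefore-other (X ++ Y) (v∉X ∘ here) ⟩
    𝟙 (inv? π x v) + adjBefore (X ++ Y) v          ≡⟨ cong (𝟙 (inv? π x v) +_) (adjBefore-++ X Y (v∉X ∘ there)) ⟩
    𝟙 (inv? π x v) + (adjCount X v + adjBefore Y v) ≡⟨ +-assoc (𝟙 (inv? π x v)) _ _ ⟨
    adjCount (x ∷ X) v + adjBefore Y v             ∎
    where open ≡-Reasoning

  adjBefore≤adjCount : ∀ L v → adjBefore L v ≤ adjCount L v
  adjBefore≤adjCount []      v = z≤n
  adjBefore≤adjCount (x ∷ L) v with v ≟ x
  ... | yes _ = z≤n
  ... | no  _ = +-monoʳ-≤ (𝟙 (inv? π x v)) (adjBefore≤adjCount L v)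

  adjBefore-block : ∀ B Y {v} → NoInversions π B → v ∈ B → adjBefore (B ++ Y) v ≡ 0
  adjBefore-block (x ∷ B) Y {v} noInv v∈B with v ≟ x
  ... | yes _ = refl
  ... | no v≢x with v∈B
  ...   | here v≡x    = ⊥-elim (v≢x v≡x)
  ...   | there v∈B′ rewrite ¬-not (noInv (here refl) v∈B) =
    adjBefore-block B Y (λ i∈B j∈B → noInv (there i∈B) (there j∈B)) v∈B′

  -- Of two adjacent vertices, the later one has the earlier one as a neighbour before it.
  adjBefore-Adj : ∀ X {u v} → u ∈ X → v ∈ X → Adj π u v → 0 < adjBefore X u + adjBefore X v
  adjBefore-Adj (x ∷ X) {u} {v} u∈X v∈X adj = by-cases (u ≟ x) (v ≟ x)
    where
    open ≤-Reasoning
    by-cases : Dec (u ≡ x) → Dec (v ≡ x) → 0 < adjBefore (x ∷ X) u + adjBefore (x ∷ X) v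
    by-cases (yes refl) _ = begin
      1                                        ≡⟨ cong 𝟙 adj ⟨
      𝟙 (inv? π u v)                           ≤⟨ m≤m+n _ _ ⟩
      𝟙 (inv? π u v) + adjBefore X v           ≡⟨ adjBefore-other X (Adj⇒≢ adj ∘ sym) ⟨
      adjBefore (u ∷ X) v                      ≤⟨ m≤n+m _ _ ⟩
      adjBefore (u ∷ X) u + adjBefore (u ∷ X) v ∎
    by-cases (no u≢x) (yes refl) = begin
      1                                        ≡⟨ cong 𝟙 (trans (inv?-sym v u) adj) ⟨
      𝟙 (inv? π v u)                           ≤⟨ m≤m+n _ _ ⟩
      𝟙 (inv? π v u) + adjBefore X u           ≡⟨ adjBefore-other X u≢x ⟨
      adjBefore (v ∷ X) u                      ≤⟨ m≤m+n _ _ ⟩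
      adjBefore (v ∷ X) u + adjBefore (v ∷ X) v ∎
    by-cases (no u≢x) (no v≢x) = begin
      1                                        ≤⟨ adjBefore-Adj X (Any.tail u≢x u∈X) (Any.tail v≢x v∈X) adj ⟩
      adjBefore X u + adjBefore X v            ≤⟨ +-mono-≤ (m≤n+m _ (𝟙 (inv? π x u))) (m≤n+m _ (𝟙 (inv? π x v))) ⟩
      (𝟙 (inv? π x u) + adjBefore X u) + (𝟙 (inv? π x v) + adjBefore X v)
        ≡⟨ cong₂ _+_ (adjBefore-other X u≢x) (adjBefore-other X v≢x) ⟨
      adjBefore (x ∷ X) u + adjBefore (x ∷ X) v ∎

  adjCount<adjBefore : ∀ T B R → Linked (LinkedBlocks π) (B ∷ R) → Unique (T ++ concat (B ∷ R)) →
                       ∀ {w} → w ∈ concat R → adjCount T w < adjBefore (T ++ concat (B ∷ R)) w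
  adjCount<adjBefore T B (B₂ ∷ R) (linked ∷ rest) uQ {w} w∈ with ∈-++⁻ B₂ w∈
  ... | inj₁ w∈B₂ = begin-strict
    adjCount T w                                       <⟨ m<m+n _ (∃⇒count>0 _ i′∈B (trans (inv?-sym i′ w) adj)) ⟩
    adjCount T w + adjCount B w                        ≡⟨ adjCount-++ T B w ⟨
    adjCount (T ++ B) w                                ≤⟨ m≤m+n _ _ ⟩
    adjCount (T ++ B) w + adjBefore (concat (B₂ ∷ R)) w ≡⟨ adjBefore-++ (T ++ B) _ w∉TB ⟨
    adjBefore ((T ++ B) ++ concat (B₂ ∷ R)) w          ≡⟨ cong (λ Q → adjBefore Q w) (++-assoc T B _) ⟩
    adjBefore (T ++ concat (B ∷ B₂ ∷ R)) w             ∎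
    where
    open ≤-Reasoning
    i′ : Fin n
    i′ = proj₁ (All.lookup linked w∈B₂)
    i′∈B : i′ ∈ B
    i′∈B = proj₁ (proj₂ (All.lookup linked w∈B₂))
    adj : Adj π w i′
    adj = proj₂ (proj₂ (All.lookup linked w∈B₂))
    w∉TB : w ∉ T ++ B
    w∉TB w∈TB = Unique-++-disjoint (subst Unique (sym (++-assoc T B _)) uQ) w∈TB (∈-++⁺ˡ w∈B₂)
  ... | inj₂ w∈R = begin-strict
    adjCount T w                                ≤⟨ m≤m+n _ _ ⟩
    adjCount T w + adjCount B w                 ≡⟨ adjCount-++ T B w ⟨
    adjCount (T ++ B) w                         <⟨ adjCount<adjBefore (T ++ B) B₂ R rest
                                                     (subst Unique (sym (++-assoc T B _)) uQ) w∈R ⟩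
    adjBefore ((T ++ B) ++ concat (B₂ ∷ R)) w   ≡⟨ cong (λ Q → adjBefore Q w) (++-assoc T B _) ⟩
    adjBefore (T ++ concat (B ∷ B₂ ∷ R)) w      ∎
    where open ≤-Reasoning

  topple-adjBefore : ∀ (c : Config n) v L {w} → w ≢ v →
                     topple π c v w + adjBefore L w ≡ c w + adjBefore (v ∷ L) w
  topple-adjBefore c v L {w} w≢v = begin
    topple π c v w + adjBefore L w             ≡⟨ cong (_+ adjBefore L w) (topple-other c w≢v) ⟩
    (𝟙 (inv? π v w) + c w) + adjBefore L w     ≡⟨ xy∙z≈y∙xz (𝟙 (inv? π v w)) (c w) (adjBefore L w) ⟩
    c w + (𝟙 (inv? π v w) + adjBefore L w)     ≡⟨ cong (c w +_) (adjBefore-other L w≢v) ⟨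
    c w + adjBefore (v ∷ L) w                  ∎
    where open ≡-Reasoning

  Legal⇒deg≤ : ∀ (c : Config n) L → Legal π c L → Unique L → All (λ v → deg π v ≤ c v + adjBefore L v) L
  Legal⇒deg≤ c []      _              _            = []
  Legal⇒deg≤ c (v ∷ L) (dv≤cv , lg) (v∉L ∷ uL) =
    ≤-trans dv≤cv (≤-reflexive (sym (+-adjBefore-self (c v) v L))) ∷
    All.zipWith (λ (dw≤ , v≢w) → ≤-trans dw≤ (≤-reflexive (topple-adjBefore c v L (v≢w ∘ sym))))
                (Legal⇒deg≤ (topple π c v) L lg uL , v∉L)

  deg≤⇒Legal : ∀ (c : Config n) L → Unique L → All (λ v → deg π v ≤ c v + adjBefore L v) L → Legal π c L
  deg≤⇒Legal c []      _            _                 = tt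
  deg≤⇒Legal c (v ∷ L) (v∉L ∷ uL) (dv≤ ∷ deg≤) =
    ≤-trans dv≤ (≤-reflexive (+-adjBefore-self (c v) v L)) ,
    deg≤⇒Legal (topple π c v) L uL
      (All.zipWith (λ (dw≤ , v≢w) → ≤-trans dw≤ (≤-reflexive (sym (topple-adjBefore c v L (v≢w ∘ sym)))))
                   (deg≤ , v∉L))

  innerEdges : List (Fin n) → ℕ
  innerEdges []       = 0
  innerEdges (x ∷ xs) = adjCount xs x + innerEdges xs

  innerEdges-↭ : ∀ {xs ys} → xs ↭ ys → innerEdges xs ≡ innerEdges ys
  innerEdges-↭ _↭_.refl              = refl
  innerEdges-↭ (prep x xs↭ys)        = cong₂ _+_ (count-↭ _ xs↭ys) (innerEdges-↭ xs↭ys)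
  innerEdges-↭ (_↭_.trans xs↭ys ys↭zs) = trans (innerEdges-↭ xs↭ys) (innerEdges-↭ ys↭zs)
  innerEdges-↭ {x ∷ y ∷ xs} {.y ∷ .x ∷ ys} (swap .x .y xs↭ys) = begin
    (𝟙 (inv? π y x) + adjCount xs x) + (adjCount xs y + innerEdges xs)
      ≡⟨ cong₂ (λ a b → (𝟙 (inv? π y x) + a) + (b + innerEdges xs)) (count-↭ _ xs↭ys) (count-↭ _ xs↭ys) ⟩
    (𝟙 (inv? π y x) + adjCount ys x) + (adjCount ys y + innerEdges xs)
      ≡⟨ cong (λ e → (𝟙 (inv? π y x) + adjCount ys x) + (adjCount ys y + e)) (innerEdges-↭ xs↭ys) ⟩
    (i + p) + (q + e)  ≡⟨ +-assoc i p (q + e) ⟩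
    i + (p + (q + e))  ≡⟨ cong (i +_) (x∙yz≈y∙xz p q e) ⟩
    i + (q + (p + e))  ≡⟨ +-assoc i q (p + e) ⟨
    (i + q) + (p + e)  ≡⟨ cong (λ b → (𝟙 b + q) + (p + e)) (inv?-sym y x) ⟩
    (𝟙 (inv? π x y) + adjCount ys y) + (adjCount ys x + innerEdges ys) ∎
    where
    open ≡-Reasoning
    i p q e : ℕ
    i = 𝟙 (inv? π y x)
    p = adjCount ys x
    q = adjCount ys y
    e = innerEdges ys

  -- Each inner edge is counted once from each of its two endpoints.
  sumOver-adjCount : ∀ L → sumOver (adjCount L) L ≡ innerEdges L + innerEdges L
  sumOver-adjCount []      = refl
  sumOver-adjCount (v ∷ L) = begin
    adjCount (v ∷ L) v + sumOver (adjCount (v ∷ L)) L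
      ≡⟨ cong (λ b → 𝟙 b + r + sumOver (adjCount (v ∷ L)) L) (inv?-irrefl v) ⟩
    r + sumOver (λ w → 𝟙 (inv? π v w) + adjCount L w) L
      ≡⟨ cong (r +_) (sumOver-+ (λ w → 𝟙 (inv? π v w)) (adjCount L) L) ⟩
    r + (sumOver (λ w → 𝟙 (inv? π v w)) L + sumOver (adjCount L) L)
      ≡⟨ cong₂ (λ a b → r + (a + b)) (trans (sumOver-𝟙 (inv? π v) L) (count-cong (All.universal (inv?-sym v) L)))
                                      (sumOver-adjCount L) ⟩
    r + (r + (e + e))  ≡⟨ +-assoc r r (e + e) ⟨
    (r + r) + (e + e)  ≡⟨ +-interchange r r e e ⟩
    (r + e) + (r + e)  ∎
    where
    open ≡-Reasoning
    r e : ℕ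
    r = adjCount L v
    e = innerEdges L

  sumOver-adjBefore : ∀ L → Unique L → sumOver (adjBefore L) L ≡ innerEdges L
  sumOver-adjBefore []      _            = refl
  sumOver-adjBefore (v ∷ L) (v∉L ∷ uL) = begin
    adjBefore (v ∷ L) v + sumOver (adjBefore (v ∷ L)) L
      ≡⟨ cong₂ _+_ (adjBefore-self v L)
                   (sumOver-cong (All.map (λ v≢w → adjBefore-other L (v≢w ∘ sym)) v∉L)) ⟩
    sumOver (λ w → 𝟙 (inv? π v w) + adjBefore L w) L
      ≡⟨ sumOver-+ (λ w → 𝟙 (inv? π v w)) (adjBefore L) L ⟩
    sumOver (λ w → 𝟙 (inv? π v w)) L + sumOver (adjBefore L) L
      ≡⟨ cong₂ _+_ (trans (sumOver-𝟙 (inv? π v) L) (count-cong (All.universal (inv?-sym v) L)))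
                   (sumOver-adjBefore L uL) ⟩
    adjCount L v + innerEdges L ∎
    where open ≡-Reasoning

  upperAdjCount : List (Fin n) → Fin n → ℕ
  upperAdjCount L a = count (λ b → (toℕ a <ᵇ toℕ b) ∧ inv? π a b) L

  innerEdges-sorted : ∀ L → AllPairs Fin._<_ L → innerEdges L ≡ sumOver (upperAdjCount L) L
  innerEdges-sorted []      _              = refl
  innerEdges-sorted (x ∷ L) (x<L ∷ sorted) = cong₂ _+_ lower-x upper-rest
    where
    lower-x : adjCount L x ≡ upperAdjCount (x ∷ L) x
    lower-x = sym (trans (cong (λ b → 𝟙 (b ∧ inv? π x x) + upperAdjCount L x) (<ᵇ-irrefl (toℕ x)))
                         (count-cong (All.map (λ {b} x<b → trans (cong (_∧ inv? π x b) (<⇒<ᵇ≡true x<b)) (inv?-sym x b)) x<L)))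
    upper-rest : innerEdges L ≡ sumOver (upperAdjCount (x ∷ L)) L
    upper-rest = trans (innerEdges-sorted L sorted)
                       (sumOver-cong (All.map (λ {a} x<a → cong (λ b → 𝟙 (b ∧ inv? π a x) + upperAdjCount L a) (sym (≤⇒<ᵇ≡false (<⇒≤ x<a)))) x<L))

  numEdges≡innerEdges : ∀ {Q} → Q ↭ allFin n → numEdges π ≡ innerEdges Q
  numEdges≡innerEdges {Q} Q↭ = begin
    numEdges π
      ≡⟨ sumOver-cong (All.universal (λ a → length-filter≡count (λ b → (toℕ a <ᵇ toℕ b) ∧ inv? π a b) (allFin n)) (allFin n)) ⟩
    sumOver (upperAdjCount (allFin n)) (allFin n)
      ≡⟨ innerEdges-sorted (allFin n) (Linked.Linked⇒AllPairs Fin.<-trans (allFin-sorted n)) ⟨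
    innerEdges (allFin n)
      ≡⟨ innerEdges-↭ Q↭ ⟨
    innerEdges Q
      ∎
    where open ≡-Reasoning

  sumOver-deg : ∀ {Q} → Q ↭ allFin n → sumOver (deg π) Q ≡ innerEdges Q + innerEdges Q
  sumOver-deg {Q} Q↭ = trans (sumOver-cong (All.universal (λ v → trans (deg≡adjCount-allFin v) (count-↭ _ (↭-sym Q↭))) Q))
                            (sumOver-adjCount Q)

  -- c is the configuration that the order Q topples with no grain to spare.
  OrderConfig : List (Fin n) → Config n → Set
  OrderConfig Q c = ∀ v → c v + adjBefore Q v ≡ deg π v

  orderConfig : List (Fin n) → Config n
  orderConfig Q v = deg π v ∸ adjBefore Q v

  orderConfig-OrderConfig : ∀ {Q} → Unique Q → OrderConfig Q (orderConfig Q)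
  orderConfig-OrderConfig {Q} uQ v = m∸n+n≡m (≤-trans (adjBefore≤adjCount Q v) (adjCount≤deg v uQ))

  total+innerEdges : ∀ (c : Config n) {Q} → Q ↭ allFin n →
                     total c + innerEdges Q ≡ sumOver (λ v → c v + adjBefore Q v) Q
  total+innerEdges c {Q} Q↭ = begin
    total c + innerEdges Q                          ≡⟨ cong₂ _+_ (sumOver-↭ c Q↭) (sumOver-adjBefore Q uQ) ⟨
    sumOver c Q + sumOver (adjBefore Q) Q           ≡⟨ sumOver-+ c (adjBefore Q) Q ⟨
    sumOver (λ v → c v + adjBefore Q v) Q           ∎
    where
    open ≡-Reasoning
    uQ : Unique Q
    uQ = ↭-allFin⇒Unique Q↭

  -- At level zero the inequalities deg v ≤ c v + adjBefore Q v of a legal order sum to an equality.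
  levelZero⇒OrderConfig : ∀ (c : Config n) {Q} → Q ↭ allFin n → Legal π c Q → total c ≡ numEdges π →
                          OrderConfig Q c
  levelZero⇒OrderConfig c {Q} Q↭ lg level0 v =
    sym (All.lookup (sumOver-≡⇒pointwise (Legal⇒deg≤ c Q lg uQ) sums) (↭-allFin⇒∈ Q↭ v))
    where
    open ≡-Reasoning
    uQ : Unique Q
    uQ = ↭-allFin⇒Unique Q↭
    sums : sumOver (deg π) Q ≡ sumOver (λ v → c v + adjBefore Q v) Q
    sums = begin
      sumOver (deg π) Q                     ≡⟨ sumOver-deg Q↭ ⟩
      innerEdges Q + innerEdges Q           ≡⟨ cong (_+ innerEdges Q) (trans level0 (numEdges≡innerEdges Q↭)) ⟨
      total c + innerEdges Q                ≡⟨ total+innerEdges c Q↭ ⟩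
      sumOver (λ v → c v + adjBefore Q v) Q ∎

  OrderConfig⇒levelZero : ∀ (c : Config n) {Q} → Q ↭ allFin n → OrderConfig Q c → total c ≡ numEdges π
  OrderConfig⇒levelZero c {Q} Q↭ oc = +-cancelʳ-≡ (innerEdges Q) _ _ (begin
    total c + innerEdges Q                ≡⟨ total+innerEdges c Q↭ ⟩
    sumOver (λ v → c v + adjBefore Q v) Q ≡⟨ sumOver-cong (All.universal oc Q) ⟩
    sumOver (deg π) Q                     ≡⟨ sumOver-deg Q↭ ⟩
    innerEdges Q + innerEdges Q           ≡⟨ cong (_+ innerEdges Q) (numEdges≡innerEdges Q↭) ⟨
    numEdges π + innerEdges Q             ∎)
    where open ≡-Reasoning

  OrderConfig⇒Legal : ∀ (c : Config n) {Q} → Unique Q → OrderConfig Q c → Legal π c Q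
  OrderConfig⇒Legal c {Q} uQ oc = deg≤⇒Legal c Q uQ (All.universal (λ v → ≤-reflexive (sym (oc v))) Q)

  -- Canonical toppling

  module _ (s : Fin n) where

    StableOffSink : Config n → Set
    StableOffSink c = ∀ w → w ≢ s → c w < deg π w

    ∈-unstableNonSink⁺ : ∀ {c : Config n} {i} → deg π i ≤ c i → i ≢ s → i ∈ unstableNonSink π s c
    ∈-unstableNonSink⁺ {c} {i} d≤c i≢s = ∈-filter⁺ _ (∈-allFin i) unstable?
      where
      unstable? : ((deg π i ≤ᵇ c i) ∧ not ⌊ i ≟ s ⌋) ≡ true
      unstable? with deg π i ≤ᵇ c i in d≤ᵇc | i ≟ s
      ... | false | _        = ⊥-elim (subst Bool.T d≤ᵇc (≤⇒≤ᵇ d≤c))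
      ... | true  | yes i≡s = ⊥-elim (i≢s i≡s)
      ... | true  | no _     = refl

    ∈-unstableNonSink⁻ : ∀ {c : Config n} {i} → i ∈ unstableNonSink π s c → deg π i ≤ c i × i ≢ s
    ∈-unstableNonSink⁻ {c} {i} i∈ = unstable? (proj₂ (∈-filter⁻ _ {xs = allFin n} i∈))
      where
      unstable? : ((deg π i ≤ᵇ c i) ∧ not ⌊ i ≟ s ⌋) ≡ true → deg π i ≤ c i × i ≢ s
      unstable? with deg π i ≤ᵇ c i in d≤ᵇc | i ≟ s
      ... | true | no i≢s = λ _ → ≤ᵇ⇒≤ _ _ (subst Bool.T (sym d≤ᵇc) tt) , i≢s

    ∉-unstableNonSink : ∀ {c : Config n} {i} → i ∉ unstableNonSink π s c → i ≢ s → c i < deg π i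
    ∉-unstableNonSink i∉ i≢s = ≰⇒> λ d≤c → i∉ (∈-unstableNonSink⁺ d≤c i≢s)

    unstableNonSink-sorted : ∀ (c : Config n) → StrictlySorted (unstableNonSink π s c)
    unstableNonSink-sorted c = Linked.filter⁺ _ Fin.<-trans (allFin-sorted n)

    unstableNonSink-≡ : ∀ (c : Config n) B → StrictlySorted B →
                        (∀ {i} → deg π i ≤ c i → i ≢ s → i ∈ B) → (∀ {i} → i ∈ B → deg π i ≤ c i × i ≢ s) →
                        unstableNonSink π s c ≡ B
    unstableNonSink-≡ c B sorted complete sound = StrictlySorted-≡ (unstableNonSink-sorted c) sorted
      (λ i∈ → let d≤c , i≢s = ∈-unstableNonSink⁻ i∈ in complete d≤c i≢s)
      (λ i∈B → let d≤c , i≢s = sound i∈B in ∈-unstableNonSink⁺ d≤c i≢s)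

    -- R is the list of blocks that CanonTop produces from c once T has been toppled.
    IsRun : Config n → List (Fin n) → List (List (Fin n)) → Set
    IsRun c T []      = unstableNonSink π s (toppleAll π c T) ≡ []
    IsRun c T (U ∷ R) = NonEmpty U × unstableNonSink π s (toppleAll π c T) ≡ U × IsRun c (T ++ U) R

    IsRun⇒canonSteps : ∀ (c : Config n) T R f → IsRun c T R → length R ≤ f →
                       canonSteps f π s (toppleAll π c T) ≡ R
    IsRun⇒canonSteps c T [] zero    _   _ = refl
    IsRun⇒canonSteps c T [] (suc f) U≡[] _ rewrite U≡[] = refl
    IsRun⇒canonSteps c T ((x ∷ xs) ∷ R) (suc f) (_ , U≡ , run) (s≤s len≤f) rewrite U≡ =
      cong ((x ∷ xs) ∷_) (trans (cong (canonSteps f π s) (sym (toppleAll-++ c T (x ∷ xs))))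
                                (IsRun⇒canonSteps c (T ++ x ∷ xs) R f run len≤f))

    IsRun⇒length≤ : ∀ (c : Config n) T R → IsRun c T R → length R ≤ length (concat R)
    IsRun⇒length≤ c T []             _           = z≤n
    IsRun⇒length≤ c T ((x ∷ xs) ∷ R) (_ , _ , run) = begin
      suc (length R)                   ≤⟨ s≤s (IsRun⇒length≤ c (T ++ x ∷ xs) R run) ⟩
      suc (length (concat R))          ≤⟨ s≤s (m≤n+m _ (length xs)) ⟩
      suc (length xs + length (concat R)) ≡⟨ cong suc (length-++ xs) ⟨
      length (x ∷ xs ++ concat R)      ∎
      where open ≤-Reasoning

    IsRun⇒canonTop : ∀ (c : Config n) R → IsRun c (s ∷ []) R → (s ∷ concat R) ↭ allFin n →
                     canonTop π s c ≡ (s ∷ []) ∷ R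
    IsRun⇒canonTop c R run Q↭ = cong ((s ∷ []) ∷_) (IsRun⇒canonSteps c (s ∷ []) R n run (begin
      length R                   ≤⟨ IsRun⇒length≤ c (s ∷ []) R run ⟩
      length (concat R)          <⟨ n<1+n _ ⟩
      length (s ∷ concat R)      ≡⟨ ↭-length Q↭ ⟩
      length (allFin n)          ≡⟨ length-tabulate _ ⟩
      n                          ∎))
      where open ≤-Reasoning

    IsRun⇒blocks : ∀ (c : Config n) T R → IsRun c T R → All (λ B → NonEmpty B × StrictlySorted B) R
    IsRun⇒blocks c T []      _                  = []
    IsRun⇒blocks c T (U ∷ R) (nonEmpty , U≡ , run) =
      (nonEmpty , subst StrictlySorted U≡ (unstableNonSink-sorted _)) ∷ IsRun⇒blocks c (T ++ U) R run

    IsRun⇒stabilised : ∀ (c : Config n) T R → IsRun c T R →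
                       unstableNonSink π s (toppleAll π c (T ++ concat R)) ≡ []
    IsRun⇒stabilised c T []      U≡[] = subst (λ T′ → unstableNonSink π s (toppleAll π c T′) ≡ []) (sym (++-identityʳ T)) U≡[]
    IsRun⇒stabilised c T (U ∷ R) (_ , _ , run) =
      subst (λ T′ → unstableNonSink π s (toppleAll π c T′) ≡ []) (++-assoc T U (concat R)) (IsRun⇒stabilised c (T ++ U) R run)

    toppled-stable : ∀ (c : Config n) T {w} → StableOffSink c → Legal π c T → Unique T → w ∈ T → w ≢ s →
                     toppleAll π c T w < deg π w
    toppled-stable c T {w} stable lgT uT w∈T w≢s = +-cancelʳ-< _ _ _ (begin-strict
      toppleAll π c T w + deg π w ≡⟨ toppleAll-∈ c T lgT uT w∈T ⟩
      c w + adjCount T w          <⟨ +-monoˡ-< (adjCount T w) (stable w w≢s) ⟩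
      deg π w + adjCount T w      ≤⟨ +-monoʳ-≤ (deg π w) (adjCount≤deg w uT) ⟩
      deg π w + deg π w           ∎)
      where open ≤-Reasoning

    unstable-step : ∀ (c : Config n) T → StableOffSink c → Legal π c T → Unique T →
                    let U = unstableNonSink π s (toppleAll π c T) in Unique (T ++ U) × Legal π c (T ++ U)
    unstable-step c T stable lgT uT = Unique.++⁺ uT uU disjoint , Legal-++⁺ c T U lgT lgU
      where
      c′ : Config n
      c′ = toppleAll π c T
      U : List (Fin n)
      U = unstableNonSink π s c′
      uU : Unique U
      uU = StrictlySorted⇒Unique (unstableNonSink-sorted c′)
      disjoint : ∀ {u} → ¬ (u ∈ T × u ∈ U)
      disjoint (u∈T , u∈U) = let d≤c , u≢s = ∈-unstableNonSink⁻ u∈U in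
        <⇒≱ (toppled-stable c T stable lgT uT u∈T u≢s) d≤c
      lgU : Legal π c′ U
      lgU = deg≤⇒Legal c′ U uU (All.tabulate λ u∈U → ≤-trans (proj₁ (∈-unstableNonSink⁻ u∈U)) (m≤m+n _ _))

    -- The run must stop within n steps: each block is nonempty and disjoint from what was toppled before.
    canonicalRun : ∀ (c : Config n) f T → StableOffSink c → n < length T + f → Legal π c T → Unique T →
                   Σ (List (List (Fin n))) λ R → IsRun c T R × Legal π c (T ++ concat R) × Unique (T ++ concat R)
    canonicalRun c zero T _ n<T _ uT = ⊥-elim (<⇒≱ n<T (begin
      length T + 0      ≡⟨ +-identityʳ _ ⟩
      length T          ≤⟨ length-mono-⊆ uT (λ _ → ∈-allFin _) ⟩
      length (allFin n) ≡⟨ length-tabulate _ ⟩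
      n                 ∎))
      where open ≤-Reasoning
    canonicalRun c (suc f) T stable n<T lgT uT =
      continue (unstableNonSink π s (toppleAll π c T)) refl (unstable-step c T stable lgT uT)
      where
      continue : ∀ U → unstableNonSink π s (toppleAll π c T) ≡ U → Unique (T ++ U) × Legal π c (T ++ U) →
                 Σ (List (List (Fin n))) λ R → IsRun c T R × Legal π c (T ++ concat R) × Unique (T ++ concat R)
      continue []       U≡[] _ = [] , U≡[] , subst (Legal π c) (sym (++-identityʳ T)) lgT , subst Unique (sym (++-identityʳ T)) uT
      continue (x ∷ xs) U≡ (uTU , lgTU)
        with canonicalRun c f (T ++ x ∷ xs) stable
               (≤-trans n<T (≤-trans (≤-reflexive (+-suc (length T) f)) (+-monoˡ-≤ f (length<length-++-∷ T))))
               lgTU uTU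
      ... | R , run , lg , u = (x ∷ xs) ∷ R , (tt , U≡ , run) ,
                               subst (Legal π c) (++-assoc T (x ∷ xs) (concat R)) lg ,
                               subst Unique (++-assoc T (x ∷ xs) (concat R)) u

    -- The first vertex of a legal full order that is missing from T would be unstable after toppling T.
    stabilised-covers : ∀ (c : Config n) {L T} → Legal π c L → L ↭ allFin n → s ∈ T →
                        unstableNonSink π s (toppleAll π c T) ≡ [] → ∀ w → w ∈ T
    stabilised-covers c {L} {T} lgL L↭ s∈T stabilised w =
      All.lookup (walk [] L (↭-allFin⇒Unique L↭) [] lgL) (↭-allFin⇒∈ L↭ w)
      where
      walk : ∀ pre rest → Unique (pre ++ rest) → All (_∈ T) pre → Legal π (toppleAll π c pre) rest → All (_∈ T) rest
      walk pre []         _ _       _            = []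
      walk pre (w ∷ rest) u pre⊆T (dw≤ , lg) = w∈T ∷ walk (pre ++ [ w ]) rest
        (subst Unique (sym (++-assoc pre [ w ] rest)) u) (All.++⁺ pre⊆T (w∈T ∷ []))
        (subst (λ c′ → Legal π c′ rest) (sym (toppleAll-++ c pre [ w ])) lg)
        where
        w∈T : w ∈ T
        w∈T with Any.any? (w ≟_) T
        ... | yes w∈T = w∈T
        ... | no  w∉T = ⊥-elim (<⇒≱ stable (begin
          deg π w              ≤⟨ dw≤ ⟩
          toppleAll π c pre w  ≡⟨ toppleAll-∉ c pre (w∉T ∘ All.lookup pre⊆T) ⟩
          c w + adjCount pre w ≤⟨ +-monoʳ-≤ (c w) (count-mono-⊆ _ (Unique-++⁻ˡ pre u) (All.lookup pre⊆T)) ⟩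
          c w + adjCount T w   ≡⟨ toppleAll-∉ c T w∉T ⟨
          toppleAll π c T w    ∎))
          where
          open ≤-Reasoning
          stable : toppleAll π c T w < deg π w
          stable = ∉-unstableNonSink (¬Any[] ∘ subst (w ∈_) stabilised) λ w≡s → w∉T (subst (_∈ T) (sym w≡s) s∈T)

    -- A vertex that becomes unstable only once Prev has been toppled received a grain from Prev.
    IsRun⇒linked : ∀ (c : Config n) Tp Prev R → IsRun c (Tp ++ Prev) R → Unique ((Tp ++ Prev) ++ concat R) →
                   (∀ u → u ∉ Tp ++ Prev → u ≢ s → toppleAll π c Tp u < deg π u) →
                   Linked (LinkedBlocks π) (Prev ∷ R)
    IsRun⇒linked c Tp Prev []      _ _ _ = [-]
    IsRun⇒linked c Tp Prev (U ∷ R) (_ , U≡ , run) uQ stableTp =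
      All.tabulate neighbour ∷
      IsRun⇒linked c (Tp ++ Prev) U R run (subst Unique (sym (++-assoc (Tp ++ Prev) U (concat R))) uQ) stableT
      where
      T : List (Fin n)
      T = Tp ++ Prev
      u∉T : ∀ {u} → u ∈ U → u ∉ T
      u∉T u∈U u∈T = Unique-++-disjoint uQ u∈T (∈-++⁺ˡ u∈U)
      stableT : ∀ u → u ∉ T ++ U → u ≢ s → toppleAll π c T u < deg π u
      stableT u u∉ = ∉-unstableNonSink (λ u∈U′ → u∉ (∈-++⁺ʳ T (subst (u ∈_) U≡ u∈U′)))
      neighbour : ∀ {u} → u ∈ U → ∃ λ i′ → i′ ∈ Prev × Adj π u i′
      neighbour {u} u∈U with count>0⇒∃ (λ v → inv? π v u) Prev (+-cancelˡ-< a 0 _ (begin-strict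
          a + 0                                      ≡⟨ +-identityʳ a ⟩
          c u + adjCount Tp u                        ≡⟨ toppleAll-∉ c Tp (u∉T u∈U ∘ ∈-++⁺ˡ) ⟨
          toppleAll π c Tp u                         <⟨ stableTp u (u∉T u∈U) u≢s ⟩
          deg π u                                    ≤⟨ d≤c ⟩
          toppleAll π c T u                          ≡⟨ toppleAll-∉ c T (u∉T u∈U) ⟩
          c u + adjCount T u                         ≡⟨ cong (c u +_) (adjCount-++ Tp Prev u) ⟩
          c u + (adjCount Tp u + adjCount Prev u)    ≡⟨ +-assoc (c u) _ _ ⟨
          a + adjCount Prev u                        ∎))
        where
        open ≤-Reasoning
        a : ℕ
        a = c u + adjCount Tp u
        unstable : deg π u ≤ toppleAll π c T u × u ≢ s
        unstable = ∈-unstableNonSink⁻ (subst (u ∈_) (sym U≡) u∈U)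
        d≤c : deg π u ≤ toppleAll π c T u
        d≤c = proj₁ unstable
        u≢s : u ≢ s
        u≢s = proj₂ unstable
      ... | i′ , i′∈Prev , adj = i′ , i′∈Prev , trans (inv?-sym u i′) adj

    -- A block vertex is already unstable after T, so by OrderConfig no neighbour precedes it in its block.
    IsRun⇒noInversions : ∀ (c : Config n) T R → IsRun c T R → OrderConfig (T ++ concat R) c →
                         Unique (T ++ concat R) → All (NoInversions π) R
    IsRun⇒noInversions c T []      _              _  _  = []
    IsRun⇒noInversions c T (U ∷ R) (_ , U≡ , run) oc uQ =
      noInv ∷ IsRun⇒noInversions c (T ++ U) R run
        (subst (λ Q → OrderConfig Q c) (sym (++-assoc T U (concat R))) oc)
        (subst Unique (sym (++-assoc T U (concat R))) uQ)
      where
      none-before : ∀ {u} → u ∈ U → adjBefore (U ++ concat R) u ≡ 0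
      none-before {u} u∈U = n≤0⇒n≡0 (+-cancelˡ-≤ a _ 0 (begin
        a + adjBefore (U ++ concat R) u      ≡⟨ +-assoc (c u) _ _ ⟩
        c u + (adjCount T u + adjBefore (U ++ concat R) u) ≡⟨ cong (c u +_) (adjBefore-++ T (U ++ concat R) u∉T) ⟨
        c u + adjBefore (T ++ U ++ concat R) u ≡⟨ oc u ⟩
        deg π u                              ≤⟨ proj₁ (∈-unstableNonSink⁻ (subst (u ∈_) (sym U≡) u∈U)) ⟩
        toppleAll π c T u                    ≡⟨ toppleAll-∉ c T u∉T ⟩
        a                                    ≡⟨ +-identityʳ a ⟨
        a + 0                                ∎))
        where
        open ≤-Reasoning
        a : ℕ
        a = c u + adjCount T u
        u∉T : u ∉ T
        u∉T u∈T = Unique-++-disjoint uQ u∈T (∈-++⁺ˡ u∈U)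
      noInv : NoInversions π U
      noInv i∈U j∈U adj = <⇒≱ (adjBefore-Adj (U ++ concat R) (∈-++⁺ˡ i∈U) (∈-++⁺ˡ j∈U) adj)
        (≤-reflexive (cong₂ _+_ (none-before i∈U) (none-before j∈U)))

    module _ (c : Config n) {Q} (oc : OrderConfig Q c) (Q↭ : Q ↭ allFin n) (stable : StableOffSink c) where

      private
        uQ : Unique Q
        uQ = ↭-allFin⇒Unique Q↭

        covers : ∀ w → w ∈ Q
        covers w = ↭-allFin⇒∈ Q↭ w

      prefix-stable : ∀ T X {w} → Q ≡ T ++ X → w ∈ T → w ≢ s → toppleAll π c T w < deg π w
      prefix-stable T X Q≡ = toppled-stable c T stable
        (proj₁ (Legal-++⁻ c T X (subst (Legal π c) Q≡ (OrderConfig⇒Legal c uQ oc))))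
        (Unique-++⁻ˡ T (subst Unique Q≡ uQ))

      block-critical : ∀ T B R {i} → Q ≡ T ++ concat (B ∷ R) → NoInversions π B → i ∈ B →
                       toppleAll π c T i ≡ deg π i
      block-critical T B R {i} Q≡ noInv i∈B = begin
        toppleAll π c T i                                  ≡⟨ toppleAll-∉ c T i∉T ⟩
        c i + adjCount T i                                 ≡⟨ cong (c i +_) (+-identityʳ _) ⟨
        c i + (adjCount T i + 0)                           ≡⟨ cong (λ b → c i + (adjCount T i + b)) (adjBefore-block B (concat R) noInv i∈B) ⟨
        c i + (adjCount T i + adjBefore (B ++ concat R) i) ≡⟨ cong (c i +_) (adjBefore-++ T (B ++ concat R) i∉T) ⟨
        c i + adjBefore (T ++ B ++ concat R) i             ≡⟨ cong (λ Q → c i + adjBefore Q i) Q≡ ⟨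
        c i + adjBefore Q i                                ≡⟨ oc i ⟩
        deg π i                                            ∎
        where
        open ≡-Reasoning
        i∉T : i ∉ T
        i∉T i∈T = Unique-++-disjoint (subst Unique Q≡ uQ) i∈T (∈-++⁺ˡ i∈B)

      later-stable : ∀ T B R {i} → Q ≡ T ++ concat (B ∷ R) → Linked (LinkedBlocks π) (B ∷ R) → i ∈ concat R →
                     toppleAll π c T i < deg π i
      later-stable T B R {i} Q≡ linked i∈R = begin-strict
        toppleAll π c T i                     ≡⟨ toppleAll-∉ c T i∉T ⟩
        c i + adjCount T i                    <⟨ +-monoʳ-< (c i) (adjCount<adjBefore T B R linked (subst Unique Q≡ uQ) i∈R) ⟩
        c i + adjBefore (T ++ concat (B ∷ R)) i ≡⟨ cong (λ Q → c i + adjBefore Q i) Q≡ ⟨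
        c i + adjBefore Q i                   ≡⟨ oc i ⟩
        deg π i                               ∎
        where
        open ≤-Reasoning
        i∉T : i ∉ T
        i∉T i∈T = Unique-++-disjoint (subst Unique Q≡ uQ) i∈T (∈-++⁺ʳ B i∈R)

      compatible⇒IsRun : ∀ T R → Q ≡ T ++ concat R → s ∈ T → All (NoInversions π) R →
                         All (λ B → NonEmpty B × StrictlySorted B) R → Linked (LinkedBlocks π) R → IsRun c T R
      compatible⇒IsRun T [] Q≡T++[] _ _ _ _ =
        unstableNonSink-≡ (toppleAll π c T) [] []
          (λ {i} d≤ i≢s → ⊥-elim (<⇒≱ (prefix-stable T [] Q≡T++[] (subst (i ∈_) Q≡T (covers i)) i≢s) d≤))
          λ ()
        where
        Q≡T : Q ≡ T
        Q≡T = trans Q≡T++[] (++-identityʳ T)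
      compatible⇒IsRun T (B@(_ ∷ _) ∷ R) Q≡ s∈T (noInv ∷ noInvs) ((_ , sorted) ∷ blocks) linked =
        tt , unstableNonSink-≡ (toppleAll π c T) B sorted complete sound ,
        compatible⇒IsRun (T ++ B) R (trans Q≡ (sym (++-assoc T B (concat R)))) (∈-++⁺ˡ s∈T)
                         noInvs blocks (Linked.tail linked)
        where
        complete : ∀ {i} → deg π i ≤ toppleAll π c T i → i ≢ s → i ∈ B
        complete {i} d≤ i≢s with ∈-++⁻ T (subst (i ∈_) Q≡ (covers i))
        ... | inj₁ i∈T  = ⊥-elim (<⇒≱ (prefix-stable T _ Q≡ i∈T i≢s) d≤)
        ... | inj₂ i∈BR with ∈-++⁻ B i∈BR
        ...   | inj₁ i∈B = i∈B
        ...   | inj₂ i∈R = ⊥-elim (<⇒≱ (later-stable T B R Q≡ linked i∈R) d≤)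
        sound : ∀ {i} → i ∈ B → deg π i ≤ toppleAll π c T i × i ≢ s
        sound i∈B = ≤-reflexive (sym (block-critical T B R Q≡ noInv i∈B)) ,
                    λ { refl → Unique-++-disjoint (subst Unique Q≡ uQ) s∈T (∈-++⁺ˡ i∈B) }

    minRecurrent⇒run : ∀ (c : Config n) → MinRecurrent π s c →
                       Σ (List (List (Fin n))) λ R →
                         IsRun c (s ∷ []) R × (s ∷ concat R) ↭ allFin n × OrderConfig (s ∷ concat R) c
    minRecurrent⇒run c ((cs≡ds , stable , _ , L↭ , lgL) , level0)
      with canonicalRun c n (s ∷ []) stable (n<1+n n) (≤-reflexive (sym cs≡ds) , tt) ([] ∷ [])
    ... | R , run , lgQ , uQ = R , run , Q↭ , levelZero⇒OrderConfig c Q↭ lgQ level0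
      where
      covers : ∀ w → w ∈ s ∷ concat R
      covers = stabilised-covers c lgL L↭ (here refl) (IsRun⇒stabilised c (s ∷ []) R run)
      Q↭ : (s ∷ concat R) ↭ allFin n
      Q↭ = Unique-⊆⇒↭ uQ (Unique.allFin⁺ n) (λ _ → ∈-allFin _) (λ {w} _ → covers w)

    run⇒compatible : ∀ (c : Config n) R → StableOffSink c → IsRun c (s ∷ []) R →
                     (s ∷ concat R) ↭ allFin n → OrderConfig (s ∷ concat R) c → Compatible π s ((s ∷ []) ∷ R)
    run⇒compatible c R stable run Q↭ oc =
      (((tt , [-]) ∷ IsRun⇒blocks c (s ∷ []) R run) , Q↭) , refl ,
      (sinkNoInversions ∷ IsRun⇒noInversions c (s ∷ []) R run oc uQ) ,
      IsRun⇒linked c [] (s ∷ []) R run uQ (λ u _ → stable u)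
      where
      uQ : Unique (s ∷ concat R)
      uQ = ↭-allFin⇒Unique Q↭
      sinkNoInversions : NoInversions π (s ∷ [])
      sinkNoInversions (here refl) (here refl) adj = Adj⇒≢ {s} {s} adj refl

    compatible⇒run : ∀ R → Compatible π s ((s ∷ []) ∷ R) →
                     let c = orderConfig (s ∷ concat R) in MinRecurrent π s c × IsRun c (s ∷ []) R
    compatible⇒run R ((blocks , Q↭) , _ , (_ ∷ noInvs) , linked) =
      ((cs≡ds , stable , concat R , Q↭ , OrderConfig⇒Legal c uQ oc) , OrderConfig⇒levelZero c Q↭ oc) ,
      compatible⇒IsRun c oc Q↭ stable (s ∷ []) R refl (here refl) noInvs (All.tail blocks) (Linked.tail linked)
      where
      Q : List (Fin n)
      Q = s ∷ concat R
      c : Config n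
      c = orderConfig Q
      uQ : Unique Q
      uQ = ↭-allFin⇒Unique Q↭
      oc : OrderConfig Q c
      oc = orderConfig-OrderConfig uQ
      cs≡ds : c s ≡ deg π s
      cs≡ds = trans (sym (+-adjBefore-self (c s) s (concat R))) (oc s)
      stable : StableOffSink c
      stable w w≢s with ↭-allFin⇒∈ Q↭ w
      ... | here w≡s = ⊥-elim (w≢s w≡s)
      ... | there w∈R = begin-strict
        c w                 ≡⟨ +-identityʳ (c w) ⟨
        c w + 0             <⟨ +-monoʳ-< (c w) (adjCount<adjBefore [] (s ∷ []) R linked uQ w∈R) ⟩
        c w + adjBefore Q w ≡⟨ oc w ⟩
        deg π w             ∎
        where open ≤-Reasoning

proposition4p3 : (n : ℕ) (π : Permutation′ n) (s : Fin n) →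
    Indecomposable π →
    ((c : Config n) → MinRecurrent π s c → Compatible π s (canonTop π s c))
    × ((c c′ : Config n) → MinRecurrent π s c → MinRecurrent π s c′ →
    canonTop π s c ≡ canonTop π s c′ → (∀ i → c i ≡ c′ i))
    × ((P : List (List (Fin n))) → Compatible π s P →
    Σ (Config n) (λ c → MinRecurrent π s c × canonTop π s c ≡ P))
proposition4p3 n π s _ = compatible , injective , surjective
  where
  compatible : (c : Config n) → MinRecurrent π s c → Compatible π s (canonTop π s c)
  compatible c mr@((_ , stable , _) , _) with minRecurrent⇒run π s c mr
  ... | R , run , Q↭ , oc = subst (Compatible π s) (sym (IsRun⇒canonTop π s c R run Q↭))
                                  (run⇒compatible π s c R stable run Q↭ oc)

  injective : (c c′ : Config n) → MinRecurrent π s c → MinRecurrent π s c′ →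
              canonTop π s c ≡ canonTop π s c′ → (∀ i → c i ≡ c′ i)
  injective c c′ mr mr′ canon≡ i with minRecurrent⇒run π s c mr | minRecurrent⇒run π s c′ mr′
  ... | R , run , Q↭ , oc | R′ , run′ , Q′↭ , oc′ = +-cancelʳ-≡ _ (c i) (c′ i) (trans (oc i) (sym (oc′R i)))
    where
    R≡R′ : R ≡ R′
    R≡R′ = ∷-injectiveʳ (trans (sym (IsRun⇒canonTop π s c R run Q↭))
                                (trans canon≡ (IsRun⇒canonTop π s c′ R′ run′ Q′↭)))
    oc′R : OrderConfig π (s ∷ concat R) c′
    oc′R = subst (λ R → OrderConfig π (s ∷ concat R) c′) (sym R≡R′) oc′

  surjective : (P : List (List (Fin n))) → Compatible π s P →
               Σ (Config n) (λ c → MinRecurrent π s c × canonTop π s c ≡ P)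
  surjective (P₀ ∷ R) compat@(_ , refl , _) with compatible⇒run π s R compat
  ... | mr , run = orderConfig π (s ∷ concat R) , mr ,
                   IsRun⇒canonTop π s _ R run (proj₂ (proj₁ compat))
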